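{- Let $G$ be a graph with edge capacities, $Z\subseteq V(G)$ with $|Z|\ge 2$, and let $T$ (with bags $\{B(x):x\in Z\}$ and capacities $c'$) be a GH $Z$-tree of $G$ which occurs as a bag minor in $G$. Let $v\in Z$ and let $uv\in E(T)$ be an edge of maximum capacity $c'(uv)$ among the edges of $T$ incident to $v$. Define $B'(u)=B(u)\cup B(v)$ and $B'(x)=B(x)$ for each $x\in Z\setminus\{u,v\}$, and let $T'$ be the tree obtained from $T$ by contracting $uv$ into $u$, with capacities inherited from $c'$. Then $T'$ with bags $\{B'(x):x\in Z\setminus\{v\}\}$ is a GH $(Z\setminus\{v\})$-tree of $G$ which occurs as a bag minor in $G$.
   Context: For $A\subseteq V$, $\delta(A)$ is the set of edges with exactly one end in $A$. A minimum $st$-cut is a minimum-capacity $\delta(A)$ with $s\in A$, $t\notin A$. A GH $Z$-tree is a partition $\{B(x):x\in Z\}$ of $V(G)$ with $z\in B(z)$ (the bags), together with a tree $T$ on vertex set $Z$ with capacities $c'$ on $E(T)$, such that for every edge $st\in E(T)$, if $S$ is the vertex set of the component of $T-st$ containing $s$, then $\delta(\bigcup_{x\in S}B(x))$ is a minimum $st$-cut in $G$ of capacity $c'(st)$. $T$ occurs as a bag minor in $G$ if (i) each $G[B(x)]$ is connected and (ii) for each $st\in E(T)$ there is an edge of $G$ between $B(s)$ and $B(t)$.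
   Formalization: The edge capacities of G and the tree capacities $c'$ are rational. -}

module Defs where

open import Data.Nat using (ℕ)
open import Data.Bool using (Bool; true; false; if_then_else_; _xor_)
open import Data.Fin using (Fin; _≟_)
open import Data.Fin.Subset using (Subset; _∈_)
open import Data.List using (List; []; _∷_; length; lookup; removeAt; map; filter; foldr)
import Data.List.Membership.Propositional as LM
open import Data.Product using (Σ; _×_; _,_; proj₁; proj₂; ∃)
open import Data.Sum using (_⊎_)
open import Data.Unit using (⊤)
open import Data.Rational using (ℚ; 0ℚ; _+_; _≤_)
open import Function using (_∘_)
open import Function.Bundles using (_⇔_)
open import Relation.Nullary using (¬_; ⌊_⌋)
open import Relation.Binary.PropositionalEquality using (_≡_)

Edge : ℕ → Set
Edge n = Fin n × Fin n × ℚ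

module _ {n : ℕ} where

  src : Edge n → Fin n
  src = proj₁

  tgt : Edge n → Fin n
  tgt = proj₁ ∘ proj₂

  cap : Edge n → ℚ
  cap = proj₂ ∘ proj₂

  Adj : List (Edge n) → Fin n → Fin n → Set
  Adj E x y = ∃ λ e → e LM.∈ E × ((src e ≡ x × tgt e ≡ y) ⊎ (src e ≡ y × tgt e ≡ x))

  data Reach (E : List (Edge n)) (P : Fin n → Set) : Fin n → Fin n → Set where
    here : ∀ {x} → P x → Reach E P x x
    step : ∀ {x y z} → P x → Adj E x y → Reach E P y z → Reach E P x z

  cutCap : List (Edge n) → (Fin n → Bool) → ℚ
  cutCap G A = foldr (λ e r → if A (src e) xor A (tgt e) then cap e + r else r) 0ℚ G

  IsMinCut : List (Edge n) → Fin n → Fin n → (Fin n → Bool) → Set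
  IsMinCut G s t A =
    A s ≡ true × A t ≡ false ×
    (∀ (A' : Fin n → Bool) → A' s ≡ true → A' t ≡ false → cutCap G A ≤ cutCap G A')

  IsTree : Subset n → List (Edge n) → Set
  IsTree Z T =
    (∀ e → e LM.∈ T → src e ∈ Z × tgt e ∈ Z) ×
    (∀ x y → x ∈ Z → y ∈ Z → Reach T (λ _ → ⊤) x y) ×
    (∀ (i : Fin (length T)) →
       ¬ Reach (removeAt T i) (λ _ → ⊤) (src (lookup T i)) (tgt (lookup T i)))

  -- A is the union of the bags B(x) over the vertices x of the component of
  -- T - e_i containing s.  Bags are given by β : V → V, B(x) = { y | β y ≡ x }.
  IsSide : (T : List (Edge n)) → (Fin n → Fin n) → Fin (length T) → Fin n → (Fin n → Bool) → Set
  IsSide T β i s A = ∀ y → (A y ≡ true) ⇔ Reach (removeAt T i) (λ _ → ⊤) s (β y)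

  -- The bags {B(x) : x ∈ Z} form a partition of V with z ∈ B(z): encoded by
  -- β y ∈ Z for all y (y lies in the bag B(β y)) and β z ≡ z for z ∈ Z.
  IsGHTree : List (Edge n) → Subset n → List (Edge n) → (Fin n → Fin n) → Set
  IsGHTree G Z T β =
    IsTree Z T ×
    (∀ y → β y ∈ Z) ×
    (∀ z → z ∈ Z → β z ≡ z) ×
    (∀ (i : Fin (length T)) →
      (∀ A → IsSide T β i (src (lookup T i)) A →
         IsMinCut G (src (lookup T i)) (tgt (lookup T i)) A × cutCap G A ≡ cap (lookup T i)) ×
      (∀ A → IsSide T β i (tgt (lookup T i)) A →
         IsMinCut G (tgt (lookup T i)) (src (lookup T i)) A × cutCap G A ≡ cap (lookup T i)))

  IsBagMinor : List (Edge n) → List (Edge n) → (Fin n → Fin n) → Set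
  IsBagMinor G T β =
    (∀ x y → β x ≡ β y → Reach G (λ w → β w ≡ β x) x y) ×
    (∀ e → e LM.∈ T → ∃ λ g → g LM.∈ G ×
        ((β (src g) ≡ src e × β (tgt g) ≡ tgt e) ⊎ (β (src g) ≡ tgt e × β (tgt g) ≡ src e)))

  rename : Fin n → Fin n → Fin n → Fin n
  rename v u x = if ⌊ x ≟ v ⌋ then u else x

  contract : (T : List (Edge n)) → Fin (length T) → Fin n → Fin n → List (Edge n)
  contract T i u v = map (λ e → rename v u (src e) , rename v u (tgt e) , cap e) (removeAt T i)

  EndsAre : Edge n → Fin n → Fin n → Set
  EndsAre e u v = (src e ≡ u × tgt e ≡ v) ⊎ (src e ≡ v × tgt e ≡ u)

  Incident : Edge n → Fin n → Set
  Incident e v = (src e ≡ v) ⊎ (tgt e ≡ v)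

module Submission where

-- Write r = rename v u.  Every edge of T' is the image of an edge e_k ≠ uv of T
-- (its origin).  Walks in T project to walks in T' (uv collapses to a point),
-- and walks in T' − e'_j lift to walks in T − e_k, since vertices with equal
-- image are joined through uv.  Hence T' is a tree on Z − v, and the side of
-- r a in T' − e'_j is the side of a in T − e_k, so it is the minimum ab-cut
-- δ(A) of capacity c(e_k).  If neither end of e_k is v nothing changes; if an
-- end moves from v to u, δ(A) stays minimum because any cut separating u and v
-- costs at least c(uv) ≥ c(e_k).  The merged bag B(u) ∪ B(v) is connected
-- through the edge of G that joins the two bags.

open import Defs
open import Data.Nat using (ℕ; zero; suc; _≤_)
import Data.Nat.Properties as ℕ
open import Data.Fin using (Fin; zero; suc; _≟_)
import Data.Fin.Properties as Fin
open import Data.Fin.Subset using (Subset; _∈_; _─_; ⁅_⁆; ∣_∣)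
open import Data.Fin.Subset.Properties using (x∈p∧x≢y⇒x∈p-y; p─q⊆p)
open import Data.Bool using (Bool; true; false)
open import Data.List using (List; []; _∷_; length; lookup; map; removeAt; filter; allFin)
open import Data.List.Membership.Propositional using () renaming (_∈_ to _∈ₗ_)
open import Data.List.Membership.Propositional.Properties using (∈-lookup; ∈-allFin; ∈-map⁻; ∈-filter⁺; ∈-filter⁻)
open import Data.List.Membership.DecPropositional using () renaming (_∈?_ to member?)
import Data.List.Relation.Unary.Any as Any
open import Data.List.Relation.Unary.Any using (here; there)
open import Data.Vec.Base using (_∷_; here; there)
open import Data.List.Relation.Unary.Any.Properties using (lookup-index)
open import Data.List.Properties using (filter-notAll)
open import Data.Product using (_×_; _,_; proj₁; proj₂; ∃)
open import Data.Sum using (_⊎_; inj₁; inj₂; swap)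
open import Data.Unit using (⊤; tt)
open import Data.Empty using (⊥-elim)
open import Data.Rational using (0ℚ) renaming (_≤_ to _≤ℚ_)
import Data.Rational.Properties as ℚ
open import Function using (_∘_; case_of_)
open import Function.Bundles using (_⇔_; mk⇔; Equivalence)
open import Relation.Nullary using (¬_; Dec; yes; no; ⌊_⌋; ¬?)
open import Relation.Nullary.Decidable using (_×-dec_; _⊎-dec_)
open import Relation.Binary.PropositionalEquality using (_≡_; _≢_; refl; sym; trans; cong; subst; subst₂)
open import Relation.Binary.Construct.Closure.ReflexiveTransitive using (Star; ε; _◅_; _◅◅_; kleisliStar)
import Relation.Binary.Construct.Closure.ReflexiveTransitive as Star

module _ {a} {A : Set a} where

  skipPos : (L : List A) (k : Fin (length L)) → Fin (length (removeAt L k)) → Fin (length L)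
  skipPos (x ∷ xs) zero    p       = suc p
  skipPos (x ∷ xs) (suc k) zero    = zero
  skipPos (x ∷ xs) (suc k) (suc p) = suc (skipPos xs k p)

  lookup-skipPos : ∀ L k p → lookup (removeAt L k) p ≡ lookup L (skipPos L k p)
  lookup-skipPos (x ∷ xs) zero    p       = refl
  lookup-skipPos (x ∷ xs) (suc k) zero    = refl
  lookup-skipPos (x ∷ xs) (suc k) (suc p) = lookup-skipPos xs k p

  skipPos-≢ : ∀ L k p → skipPos L k p ≢ k
  skipPos-≢ (x ∷ xs) zero    p       ()
  skipPos-≢ (x ∷ xs) (suc k) zero    ()
  skipPos-≢ (x ∷ xs) (suc k) (suc p) eq = skipPos-≢ xs k p (Fin.suc-injective eq)

  skipPos-injective : ∀ L k {p p'} → skipPos L k p ≡ skipPos L k p' → p ≡ p'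
  skipPos-injective (x ∷ xs) zero    eq = Fin.suc-injective eq
  skipPos-injective (x ∷ xs) (suc k) {zero}  {zero}   eq = refl
  skipPos-injective (x ∷ xs) (suc k) {suc p} {suc p'} eq =
    cong suc (skipPos-injective xs k (Fin.suc-injective eq))

  skipPos-onto : ∀ L k q → q ≢ k → ∃ λ p → skipPos L k p ≡ q
  skipPos-onto (x ∷ xs) zero    zero    q≢k = ⊥-elim (q≢k refl)
  skipPos-onto (x ∷ xs) zero    (suc q) q≢k = q , refl
  skipPos-onto (x ∷ xs) (suc k) zero    q≢k = zero , refl
  skipPos-onto (x ∷ xs) (suc k) (suc q) q≢k
    with p , eq ← skipPos-onto xs k q (q≢k ∘ cong suc) = suc p , cong suc eq

  ∈-removeAt⁻ : ∀ L k {x : A} → x ∈ₗ removeAt L k → x ∈ₗ L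
  ∈-removeAt⁻ (y ∷ ys) zero    m         = there m
  ∈-removeAt⁻ (y ∷ ys) (suc k) (here eq) = here eq
  ∈-removeAt⁻ (y ∷ ys) (suc k) (there m) = there (∈-removeAt⁻ ys k m)

module _ {a b} {A : Set a} {B : Set b} (g : A → B) where

  mapPos : (L : List A) → Fin (length (map g L)) → Fin (length L)
  mapPos (x ∷ xs) zero    = zero
  mapPos (x ∷ xs) (suc p) = suc (mapPos xs p)

  lookup-mapPos : ∀ L p → lookup (map g L) p ≡ g (lookup L (mapPos L p))
  lookup-mapPos (x ∷ xs) zero    = refl
  lookup-mapPos (x ∷ xs) (suc p) = lookup-mapPos xs p

  mapPos-injective : ∀ L {p p'} → mapPos L p ≡ mapPos L p' → p ≡ p'
  mapPos-injective (x ∷ xs) {zero}  {zero}   eq = refl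
  mapPos-injective (x ∷ xs) {suc p} {suc p'} eq = cong suc (mapPos-injective xs (Fin.suc-injective eq))

  mapPos-onto : ∀ L q → ∃ λ p → mapPos L p ≡ q
  mapPos-onto (x ∷ xs) zero    = zero , refl
  mapPos-onto (x ∷ xs) (suc q) with p , eq ← mapPos-onto xs q = suc p , cong suc eq

x∉p-x : ∀ {n} (p : Subset n) x → ¬ (x ∈ p ─ ⁅ x ⁆)
x∉p-x (_ ∷ p) zero    ()
x∉p-x (_ ∷ p) (suc x) (there m) = x∉p-x p x m

module _ {n : ℕ} where

  private variable
    E L : List (Edge n)
    P P' : Fin n → Set
    a b c d x y z : Fin n
    e : Edge n

  ends-sym : EndsAre e x y → EndsAre e y x
  ends-sym (inj₁ (s , t)) = inj₂ (s , t)
  ends-sym (inj₂ (s , t)) = inj₁ (s , t)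

  ends-unique : EndsAre e a b → EndsAre e c d →
    (a ≡ c × b ≡ d) ⊎ (a ≡ d × b ≡ c)
  ends-unique (inj₁ (sa , tb)) (inj₁ (sc , td)) = inj₁ (trans (sym sa) sc , trans (sym tb) td)
  ends-unique (inj₁ (sa , tb)) (inj₂ (sd , tc)) = inj₂ (trans (sym sa) sd , trans (sym tb) tc)
  ends-unique (inj₂ (sb , ta)) (inj₁ (sc , td)) = inj₂ (trans (sym ta) td , trans (sym sb) sc)
  ends-unique (inj₂ (sb , ta)) (inj₂ (sd , tc)) = inj₁ (trans (sym ta) tc , trans (sym sb) sd)

  ends-incident : EndsAre e a b → Incident e a
  ends-incident (inj₁ (s , _)) = inj₁ s
  ends-incident (inj₂ (_ , t)) = inj₂ t

  ends? : ∀ (e : Edge n) x y → Dec (EndsAre e x y)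
  ends? e x y = ((src e ≟ x) ×-dec (tgt e ≟ y)) ⊎-dec ((src e ≟ y) ×-dec (tgt e ≟ x))

  Conn : List (Edge n) → Fin n → Fin n → Set
  Conn E = Reach E (λ _ → ⊤)

  reach-start : Reach E P x y → P x
  reach-start (here p)     = p
  reach-start (step p _ _) = p

  reach-mono : (∀ {w} → P w → P' w) → Reach E P x y → Reach E P' x y
  reach-mono h (here p)       = here (h p)
  reach-mono h (step p xy yz) = step (h p) xy (reach-mono h yz)

  reach-++ : Reach E P x y → Reach E P y z → Reach E P x z
  reach-++ (here _)       yz = yz
  reach-++ (step p xw wy) yz = step p xw (reach-++ wy yz)

  reach⇒star : Reach E P x y → Star (Adj E) x y
  reach⇒star (here _)       = ε
  reach⇒star (step _ xy yz) = xy ◅ reach⇒star yz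

  star⇒conn : Star (Adj E) x y → Conn E x y
  star⇒conn ε         = here tt
  star⇒conn (xy ◅ yz) = step tt xy (star⇒conn yz)

  -- Adjacency through an edge of L at a position satisfying Q, and walks
  -- along such edges; positions let us speak about a particular tree edge
  -- even if another edge has the same ends.

  AdjAt : (L : List (Edge n)) → (Fin (length L) → Set) → Fin n → Fin n → Set
  AdjAt L Q x y = ∃ λ q → Q q × EndsAre (lookup L q) x y

  Walk : (L : List (Edge n)) → (Fin (length L) → Set) → Fin n → Fin n → Set
  Walk L Q = Star (AdjAt L Q)

  adjAt⇒adj : ∀ {Q} → AdjAt L Q x y → Adj L x y
  adjAt⇒adj {L = L} (q , _ , ends) = lookup L q , ∈-lookup q , ends

  adj⇒adjAt : Adj L x y → AdjAt L (λ _ → ⊤) x y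
  adj⇒adjAt (e , m , ends) = Any.index m , tt , subst (λ e → EndsAre e _ _) (lookup-index m) ends

  adj-removeAt⇒adjAt : ∀ L k → Adj (removeAt L k) x y → AdjAt L (_≢ k) x y
  adj-removeAt⇒adjAt L k a with p , _ , ends ← adj⇒adjAt a =
    skipPos L k p , skipPos-≢ L k p , subst (λ e → EndsAre e _ _) (lookup-skipPos L k p) ends

  adjAt⇒adj-removeAt : ∀ L k → AdjAt L (_≢ k) x y → Adj (removeAt L k) x y
  adjAt⇒adj-removeAt L k (q , q≢k , ends) with p , refl ← skipPos-onto L k q q≢k =
    adjAt⇒adj (p , tt , subst (λ e → EndsAre e _ _) (sym (lookup-skipPos L k p)) ends)

  conn⇒walk : ∀ L → Conn L x y → Walk L (λ _ → ⊤) x y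
  conn⇒walk L = Star.map adj⇒adjAt ∘ reach⇒star

  walk⇒conn : ∀ L {Q} → Walk L Q x y → Conn L x y
  walk⇒conn L = star⇒conn ∘ Star.map adjAt⇒adj

  conn-removeAt⇒walk : ∀ L k → Conn (removeAt L k) x y → Walk L (_≢ k) x y
  conn-removeAt⇒walk L k = Star.map (adj-removeAt⇒adjAt L k) ∘ reach⇒star

  walk⇒conn-removeAt : ∀ L k → Walk L (_≢ k) x y → Conn (removeAt L k) x y
  walk⇒conn-removeAt L k = star⇒conn ∘ Star.map (adjAt⇒adj-removeAt L k)

  -- Deciding connectivity.  A side of a tree edge is a Boolean function, so to
  -- obtain one we must decide reachability in a finite graph.

  adj? : ∀ E x y → Dec (Adj E x y)
  adj? E x y with Fin.any? (λ q → ends? (lookup E q) x y)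
  ... | yes (q , ends) = yes (adjAt⇒adj (q , tt , ends))
  ... | no ¬ends = no λ xy → let (q , _ , ends) = adj⇒adjAt xy in ¬ends (q , ends)

  ≢? : ∀ (x w : Fin n) → Dec (w ≢ x)
  ≢? x w = ¬? (w ≟ x)

  without : Fin n → List (Fin n) → List (Fin n)
  without x = filter (≢? x)

  without-shorter : ∀ {k L} → x ∈ₗ L → length L ≤ suc k → length (without x L) ≤ k
  without-shorter {x = x} {L = L} x∈L len =
    ℕ.≤-pred (ℕ.≤-trans (filter-notAll (≢? x) L (Any.map (λ eq ne → ne (sym eq)) x∈L)) len)

  module _ (E : List (Edge n)) where

    last-exit : ∀ {L} x → Reach E (_∈ₗ L) a y →
      Reach E (_∈ₗ without x L) a y ⊎ (∃ λ z → Adj E x z × Reach E (_∈ₗ without x L) z y) ⊎ x ≡ y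
    last-exit {a = a} x (here a∈L) with a ≟ x
    ... | yes refl = inj₂ (inj₂ refl)
    ... | no a≢x = inj₁ (here (∈-filter⁺ (≢? x) a∈L a≢x))
    last-exit {a = a} x (step a∈L ab rest) with last-exit x rest
    ... | inj₂ exit = inj₂ exit
    ... | inj₁ avoid with a ≟ x
    ...   | yes refl = inj₂ (inj₁ (_ , ab , avoid))
    ...   | no a≢x = inj₁ (step (∈-filter⁺ (≢? x) a∈L a≢x) ab avoid)

    reach-within? : ∀ k L → length L ≤ k → ∀ x y → Dec (Reach E (_∈ₗ L) x y)
    reach-within? zero [] _ x y = no λ r → case reach-start r of λ ()
    reach-within? zero (_ ∷ _) () x y
    reach-within? (suc k) L len x y with member? _≟_ x L
    ... | no x∉L = no (x∉L ∘ reach-start)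
    ... | yes x∈L with x ≟ y
    ...   | yes refl = yes (here x∈L)
    ...   | no x≢y
      with Fin.any? (λ z → adj? E x z ×-dec reach-within? k (without x L) (without-shorter x∈L len) z y)
    ...     | yes (z , xz , zy) = yes (step x∈L xz (reach-mono (proj₁ ∘ ∈-filter⁻ (≢? x)) zy))
    ...     | no ¬exit = no λ r → case last-exit x r of λ where
                (inj₁ avoid)         → proj₂ (∈-filter⁻ (≢? x) {xs = L} (reach-start avoid)) refl
                (inj₂ (inj₁ exit))   → ¬exit exit
                (inj₂ (inj₂ x≡y))    → x≢y x≡y

    conn? : ∀ x y → Dec (Conn E x y)
    conn? x y with reach-within? (length (allFin n)) (allFin n) ℕ.≤-refl x y
    ... | yes r = yes (reach-mono (λ _ → tt) r)
    ... | no ¬r = no λ r → ¬r (reach-mono (λ {w} _ → ∈-allFin w) r)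

  sideOf : (T : List (Edge n)) → (Fin n → Fin n) → Fin (length T) → Fin n → Fin n → Bool
  sideOf T β k w y = ⌊ conn? (removeAt T k) w (β y) ⌋

  sideOf-isSide : ∀ T β k w → IsSide T β k w (sideOf T β k w)
  sideOf-isSide T β k w y with conn? (removeAt T k) w (β y)
  ... | yes r = mk⇔ (λ _ → r) (λ _ → refl)
  ... | no ¬r = mk⇔ (λ ()) (⊥-elim ∘ ¬r)

  -- A tree edge joins two distinct vertices: removing it disconnects its ends.
  tree-loopless : ∀ {Z T} → IsTree Z T → ∀ k → EndsAre (lookup T k) a b → a ≢ b
  tree-loopless {T = T} (_ , _ , minimal) k ends refl =
    minimal k (subst (Conn (removeAt T k) (src (lookup T k))) (src≡tgt ends) (here tt))
    where
    src≡tgt : EndsAre (lookup T k) a a → src (lookup T k) ≡ tgt (lookup T k)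
    src≡tgt (inj₁ (s , t)) = trans s (sym t)
    src≡tgt (inj₂ (s , t)) = trans s (sym t)

  tree-end∈ : ∀ {Z T} → IsTree Z T → ∀ k → EndsAre (lookup T k) a b → a ∈ Z
  tree-end∈ {Z = Z} (ends∈ , _) k (inj₁ (s , _)) = subst (_∈ Z) s (proj₁ (ends∈ _ (∈-lookup k)))
  tree-end∈ {Z = Z} (ends∈ , _) k (inj₂ (_ , t)) = subst (_∈ Z) t (proj₂ (ends∈ _ (∈-lookup k)))

  module _ (G : List (Edge n)) where

    SideCut : (T : List (Edge n)) → (Fin n → Fin n) → Fin (length T) → Fin n → Fin n → Edge n → Set
    SideCut T β j s t e = ∀ A → IsSide T β j s A → IsMinCut G s t A × cutCap G A ≡ cap e

    gh-edge-lower-bound : ∀ {Z T β} → IsGHTree G Z T β → ∀ k → EndsAre (lookup T k) a b →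
      ∀ A → A a ≡ true → A b ≡ false → cap (lookup T k) ≤ℚ cutCap G A
    gh-edge-lower-bound {T = T} {β} (_ , _ , _ , gh) k (inj₁ (s , t)) A Aa Ab
      with (_ , _ , minimal) , capacity ← proj₁ (gh k) _ (sideOf-isSide T β k (src (lookup T k))) =
      ℚ.≤-trans (ℚ.≤-reflexive (sym capacity))
        (minimal A (subst (λ w → A w ≡ true) (sym s) Aa) (subst (λ w → A w ≡ false) (sym t) Ab))
    gh-edge-lower-bound {T = T} {β} (_ , _ , _ , gh) k (inj₂ (s , t)) A Aa Ab
      with (_ , _ , minimal) , capacity ← proj₂ (gh k) _ (sideOf-isSide T β k (tgt (lookup T k))) =
      ℚ.≤-trans (ℚ.≤-reflexive (sym capacity))
        (minimal A (subst (λ w → A w ≡ true) (sym t) Aa) (subst (λ w → A w ≡ false) (sym s) Ab))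

    mincut-move-source : ∀ {s s' t A} → IsMinCut G s t A → A s' ≡ true →
      (∀ A' → A' s' ≡ true → A' s ≡ false → cutCap G A ≤ℚ cutCap G A') → IsMinCut G s' t A
    mincut-move-source {s} {s'} {t} {A} (_ , At , minimal) As' separate = As' , At , better
      where
      better : ∀ A' → A' s' ≡ true → A' t ≡ false → cutCap G A ≤ℚ cutCap G A'
      better A' A's' A't with A' s in A's
      ... | true  = minimal A' A's A't
      ... | false = separate A' A's' A's

    mincut-move-sink : ∀ {s t t' A} → IsMinCut G s t A → A t' ≡ false →
      (∀ A' → A' t ≡ true → A' t' ≡ false → cutCap G A ≤ℚ cutCap G A') → IsMinCut G s t' A
    mincut-move-sink {s} {t} {t'} {A} (As , _ , minimal) At' separate = As , At' , better
      where
      better : ∀ A' → A' s ≡ true → A' t' ≡ false → cutCap G A ≤ℚ cutCap G A'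
      better A' A's A't' with A' t in A't
      ... | false = minimal A' A's A't
      ... | true  = separate A' A't A't'

  ∈-minus⁻ : ∀ {Z : Subset n} {x y} → x ∈ Z ─ ⁅ y ⁆ → x ∈ Z × x ≢ y
  ∈-minus⁻ {Z = Z} {y = y} m = p─q⊆p Z ⁅ y ⁆ m , λ { refl → x∉p-x Z y m }

  rename-cases : ∀ (v u x : Fin n) → (x ≡ v × rename v u x ≡ u) ⊎ (x ≢ v × rename v u x ≡ x)
  rename-cases v u x with x ≟ v
  ... | yes x≡v = inj₁ (x≡v , refl)
  ... | no x≢v  = inj₂ (x≢v , refl)

  rename-kept : ∀ (v u : Fin n) → x ≢ v → rename v u x ≡ x
  rename-kept v u x≢v with rename-cases v u _
  ... | inj₁ (x≡v , _) = ⊥-elim (x≢v x≡v)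
  ... | inj₂ (_ , kept) = kept

  rename-merged : ∀ (v u : Fin n) → x ≡ u ⊎ x ≡ v → rename v u x ≡ u
  rename-merged {x = x} v u x∈uv with x ≟ v | x∈uv
  ... | yes _ | _       = refl
  ... | no _  | inj₁ eq = eq
  ... | no x≢v | inj₂ eq = ⊥-elim (x≢v eq)

  module _ (G : List (Edge n)) {T : List (Edge n)} {β : Fin n → Fin n} (bm : IsBagMinor G T β) where

    bags-of-ends : ∀ (g e : Edge n) →
      (β (src g) ≡ src e × β (tgt g) ≡ tgt e) ⊎ (β (src g) ≡ tgt e × β (tgt g) ≡ src e) →
      EndsAre e (β (src g)) (β (tgt g))
    bags-of-ends g e (inj₁ (s , t)) = inj₁ (sym s , sym t)
    bags-of-ends g e (inj₂ (t , s)) = inj₂ (sym s , sym t)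

    bag-link : ∀ k → EndsAre (lookup T k) a b → ∃ λ p → ∃ λ q → Adj G p q × β p ≡ a × β q ≡ b
    bag-link k ab with g , g∈G , oriented ← proj₂ bm (lookup T k) (∈-lookup k)
                  with ends-unique {e = lookup T k} (bags-of-ends g (lookup T k) oriented) ab
    ... | inj₁ (βs , βt) = src g , tgt g , (g , g∈G , inj₁ (refl , refl)) , βs , βt
    ... | inj₂ (βs , βt) = tgt g , src g , (g , g∈G , inj₂ (refl , refl)) , βt , βs

    adjacent-bags-connected : ∀ k → EndsAre (lookup T k) a b → β x ≡ a → β y ≡ b →
      Reach G (λ w → β w ≡ a ⊎ β w ≡ b) x y
    adjacent-bags-connected k ab βx βy with p , q , pq , βp , βq ← bag-link k ab =
      reach-++ (reach-mono (λ e → inj₁ (trans e βx)) (proj₁ bm _ p (trans βx (sym βp))))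
               (step (inj₁ βp) pq (reach-mono (λ e → inj₂ (trans e βq)) (proj₁ bm q _ (trans βq (sym βy)))))

module Contraction {n : ℕ} (T : List (Edge n)) (i : Fin (length T)) (u v : Fin n)
                   (uv : EndsAre (lookup T i) u v) where

  private variable
    a b x y : Fin n

  r : Fin n → Fin n
  r = rename v u

  renameEnds : Edge n → Edge n
  renameEnds e = r (src e) , r (tgt e) , cap e

  T' : List (Edge n)
  T' = contract T i u v

  origin : Fin (length T') → Fin (length T)
  origin p = skipPos T i (mapPos renameEnds (removeAt T i) p)

  lookup-origin : ∀ p → lookup T' p ≡ renameEnds (lookup T (origin p))
  lookup-origin p = trans (lookup-mapPos renameEnds (removeAt T i) p)
                          (cong renameEnds (lookup-skipPos T i (mapPos renameEnds (removeAt T i) p)))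

  origin-≢ : ∀ p → origin p ≢ i
  origin-≢ p = skipPos-≢ T i _

  origin-injective : ∀ {p p'} → origin p ≡ origin p' → p ≡ p'
  origin-injective = mapPos-injective renameEnds (removeAt T i) ∘ skipPos-injective T i

  origin-onto : ∀ q → q ≢ i → ∃ λ p → origin p ≡ q
  origin-onto q q≢i with p₀ , refl ← skipPos-onto T i q q≢i
                    with p , refl ← mapPos-onto renameEnds (removeAt T i) p₀ = p , refl

  renameEnds-ends : ∀ {e} → EndsAre e a b → EndsAre (renameEnds e) (r a) (r b)
  renameEnds-ends (inj₁ (s , t)) = inj₁ (cong r s , cong r t)
  renameEnds-ends (inj₂ (s , t)) = inj₂ (cong r s , cong r t)

  collapse : EndsAre (lookup T i) a b → r a ≡ r b
  collapse ab with ends-unique {e = lookup T i} ab uv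
  ... | inj₁ (refl , refl) = trans (rename-merged v u (inj₁ refl)) (sym (rename-merged v u (inj₂ refl)))
  ... | inj₂ (refl , refl) = trans (rename-merged v u (inj₂ refl)) (sym (rename-merged v u (inj₁ refl)))

  project : ∀ {Q : Fin (length T) → Set} {Q' : Fin (length T') → Set} →
    (∀ p → Q (origin p) → Q' p) → Walk T Q a b → Walk T' Q' (r a) (r b)
  project {Q = Q} {Q' = Q'} keep = kleisliStar r shorten
    where
    shorten : ∀ {a b} → AdjAt T Q a b → Walk T' Q' (r a) (r b)
    shorten {a} (q , Qq , ab) with q ≟ i
    ... | yes refl = subst (Walk T' Q' (r a)) (collapse ab) ε
    ... | no q≢i with p , refl ← origin-onto q q≢i =
      (p , keep p Qq , subst (λ e → EndsAre e _ _) (sym (lookup-origin p))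
                                (renameEnds-ends {e = lookup T q} ab)) ◅ ε

  uv-walk : ∀ {k} → k ≢ i → Walk T (_≢ k) u v
  uv-walk k≢i = (i , k≢i ∘ sym , uv) ◅ ε

  vu-walk : ∀ {k} → k ≢ i → Walk T (_≢ k) v u
  vu-walk k≢i = (i , k≢i ∘ sym , ends-sym {e = lookup T i} uv) ◅ ε

  merged-connected : ∀ {k} → k ≢ i → r a ≡ r b → Walk T (_≢ k) a b
  merged-connected {a = a} {b = b} k≢i ra≡rb with rename-cases v u a | rename-cases v u b
  ... | inj₁ (refl , _)  | inj₁ (refl , _)  = ε
  ... | inj₁ (refl , ra) | inj₂ (_ , rb)    =
    subst (Walk T _ v) (trans (sym ra) (trans ra≡rb rb)) (vu-walk k≢i)
  ... | inj₂ (_ , ra)    | inj₁ (refl , rb) =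
    subst (λ w → Walk T _ w v) (trans (sym rb) (trans (sym ra≡rb) ra)) (uv-walk k≢i)
  ... | inj₂ (_ , ra)    | inj₂ (_ , rb) = subst (Walk T _ a) (trans (sym ra) (trans ra≡rb rb)) ε

  lift : ∀ j → Walk T' (_≢ j) x y → r a ≡ x → r b ≡ y → Walk T (_≢ origin j) a b
  lift j ε ra rb = merged-connected (origin-≢ j) (trans ra (sym rb))
  lift j ((p , p≢j , ends) ◅ rest) ra rb
    with subst (λ e → EndsAre e _ _) (lookup-origin p) ends
  ... | inj₁ (s , t) = merged-connected (origin-≢ j) (trans ra (sym s))
                         ◅◅ (origin p , avoid , inj₁ (refl , refl)) ◅ lift j rest t rb
    where avoid = p≢j ∘ origin-injective
  ... | inj₂ (s , t) = merged-connected (origin-≢ j) (trans ra (sym t))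
                         ◅◅ (origin p , avoid , inj₂ (refl , refl)) ◅ lift j rest s rb
    where avoid = p≢j ∘ origin-injective

  conn-contract⇔ : ∀ j → Conn (removeAt T' j) (r a) (r b) ⇔ Conn (removeAt T (origin j)) a b
  conn-contract⇔ j = mk⇔
    (λ c → walk⇒conn-removeAt T (origin j) (lift j (conn-removeAt⇒walk T' j c) refl refl))
    (λ c → walk⇒conn-removeAt T' j (project (λ p q≢ p≡j → q≢ (cong origin p≡j))
                                            (conn-removeAt⇒walk T (origin j) c)))

  side-pullback : ∀ {β A} j → IsSide T' (r ∘ β) j (r a) A → IsSide T β (origin j) a A
  side-pullback j side y = mk⇔ (Equivalence.to (conn-contract⇔ j) ∘ Equivalence.to (side y))
                               (Equivalence.from (side y) ∘ Equivalence.from (conn-contract⇔ j))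

  ∈-contract⁻ : ∀ {e'} → e' ∈ₗ T' → ∃ λ e → e ∈ₗ T × e' ≡ renameEnds e
  ∈-contract⁻ m with e , e∈ , refl ← ∈-map⁻ renameEnds m = e , ∈-removeAt⁻ T i e∈ , refl

  module _ {Z : Subset n} (tree : IsTree Z T) where

    u≢v : u ≢ v
    u≢v = tree-loopless tree i uv

    u∈Z : u ∈ Z
    u∈Z = tree-end∈ tree i uv

    rename-∈ : x ∈ Z → r x ∈ Z ─ ⁅ v ⁆
    rename-∈ {x} x∈Z with rename-cases v u x
    ... | inj₁ (_ , eq)   = subst (_∈ Z ─ ⁅ v ⁆) (sym eq) (x∈p∧x≢y⇒x∈p-y u∈Z u≢v)
    ... | inj₂ (x≢v , eq) = subst (_∈ Z ─ ⁅ v ⁆) (sym eq) (x∈p∧x≢y⇒x∈p-y x∈Z x≢v)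

    rename-∉ : x ∈ Z ─ ⁅ v ⁆ → r x ≡ x
    rename-∉ x∈ = rename-kept v u (proj₂ (∈-minus⁻ x∈))

    contract-isTree : IsTree (Z ─ ⁅ v ⁆) T'
    contract-isTree = ends∈ , connected , minimal
      where
      ends∈ : ∀ e' → e' ∈ₗ T' → src e' ∈ Z ─ ⁅ v ⁆ × tgt e' ∈ Z ─ ⁅ v ⁆
      ends∈ e' m with e , e∈ , refl ← ∈-contract⁻ m =
        rename-∈ (proj₁ (proj₁ tree e e∈)) , rename-∈ (proj₂ (proj₁ tree e e∈))

      connected : ∀ x y → x ∈ Z ─ ⁅ v ⁆ → y ∈ Z ─ ⁅ v ⁆ → Conn T' x y
      connected x y x∈ y∈ = subst₂ (Conn T') (rename-∉ x∈) (rename-∉ y∈)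
        (walk⇒conn T' (project (λ _ _ → tt)
          (conn⇒walk T (proj₁ (proj₂ tree) x y (proj₁ (∈-minus⁻ x∈)) (proj₁ (∈-minus⁻ y∈))))))

      minimal : ∀ j → ¬ Conn (removeAt T' j) (src (lookup T' j)) (tgt (lookup T' j))
      minimal j rewrite lookup-origin j = proj₂ (proj₂ tree) (origin j) ∘ Equivalence.to (conn-contract⇔ j)

  contract-isBagMinor : ∀ {G β} → IsBagMinor G T β → IsBagMinor G T' (r ∘ β)
  contract-isBagMinor {G} {β} bm = merged-connected-bags , witnesses
    where
    same-bag : ∀ x y → β x ≡ β y → Reach G (λ w → r (β w) ≡ r (β x)) x y
    same-bag x y eq = reach-mono (cong r) (proj₁ bm x y eq)

    merged : ∀ {w x} → (β w ≡ u ⊎ β w ≡ v) → r (β x) ≡ u → r (β w) ≡ r (β x)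
    merged w∈uv rx = trans (rename-merged v u w∈uv) (sym rx)

    merged-connected-bags : ∀ x y → r (β x) ≡ r (β y) → Reach G (λ w → r (β w) ≡ r (β x)) x y
    merged-connected-bags x y eq with rename-cases v u (β x) | rename-cases v u (β y)
    ... | inj₁ (βx , _)  | inj₁ (βy , _)  = same-bag x y (trans βx (sym βy))
    ... | inj₁ (βx , rx) | inj₂ (_ , ry)  =
      reach-mono (λ w∈vu → merged (swap w∈vu) rx)
        (adjacent-bags-connected G bm i (ends-sym {e = lookup T i} uv) βx (trans (sym ry) (trans (sym eq) rx)))
    ... | inj₂ (_ , rx)  | inj₁ (βy , ry) =
      reach-mono (λ w∈uv → merged w∈uv (trans eq ry))
        (adjacent-bags-connected G bm i uv (trans (sym rx) (trans eq ry)) βy)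
    ... | inj₂ (_ , rx)  | inj₂ (_ , ry)  = same-bag x y (trans (sym rx) (trans eq ry))

    witnesses : ∀ e' → e' ∈ₗ T' → ∃ λ g → g ∈ₗ G ×
      ((r (β (src g)) ≡ src e' × r (β (tgt g)) ≡ tgt e') ⊎ (r (β (src g)) ≡ tgt e' × r (β (tgt g)) ≡ src e'))
    witnesses e' m with e , e∈T , refl ← ∈-contract⁻ m with proj₂ bm e e∈T
    ... | g , g∈G , inj₁ (s , t) = g , g∈G , inj₁ (cong r s , cong r t)
    ... | g , g∈G , inj₂ (s , t) = g , g∈G , inj₂ (cong r s , cong r t)

module ContractGH {n : ℕ} (G : List (Edge n)) {Z : Subset n} {T : List (Edge n)} {β : Fin n → Fin n}
  (gh : IsGHTree G Z T β) (u v : Fin n) (i : Fin (length T)) (uv : EndsAre (lookup T i) u v)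
  (maximum : ∀ j → Incident (lookup T j) v → cap (lookup T j) ≤ℚ cap (lookup T i)) where

  open Contraction T i u v uv

  private
    tree = proj₁ gh
    β∈Z = proj₁ (proj₂ gh)
    β-fixed = proj₁ (proj₂ (proj₂ gh))
    cuts = proj₂ (proj₂ (proj₂ gh))

  -- A cut separating u and v (either way round) is at least as expensive as
  -- any tree edge at v, by maximality of uv.
  uv-cut-bound : ∀ k → Incident (lookup T k) v → ∀ {x y} → EndsAre (lookup T i) x y →
    ∀ A' → A' x ≡ true → A' y ≡ false → cap (lookup T k) ≤ℚ cutCap G A'
  uv-cut-bound k at-v xy A' Ax Ay = ℚ.≤-trans (maximum k at-v) (gh-edge-lower-bound G gh i xy A' Ax Ay)

  β-u : β u ≡ u
  β-u = β-fixed u (u∈Z tree)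

  β-v : β v ≡ v
  β-v = β-fixed v (tree-end∈ tree i (ends-sym {e = lookup T i} uv))

  cut-transfer : ∀ k {a b A} → k ≢ i → EndsAre (lookup T k) a b → IsSide T β k a A →
    IsMinCut G a b A → cutCap G A ≡ cap (lookup T k) → IsMinCut G (r a) (r b) A
  cut-transfer k {a} {b} {A} k≢i ab side mc capacity with rename-cases v u a | rename-cases v u b
  ... | inj₁ (refl , _)  | inj₁ (refl , _) = ⊥-elim (tree-loopless tree k ab refl)
  ... | inj₁ (refl , ra) | inj₂ (_ , rb)  = subst₂ (λ s t → IsMinCut G s t A) (sym ra) (sym rb)
    (mincut-move-source G mc Au λ A' A'u A'v →
      ℚ.≤-trans (ℚ.≤-reflexive capacity) (uv-cut-bound k (ends-incident {e = lookup T k} ab) uv A' A'u A'v))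
    where
    Au : A u ≡ true
    Au = Equivalence.from (side u) (subst (Conn _ v) (sym β-u) (walk⇒conn-removeAt T k (vu-walk k≢i)))
  ... | inj₂ (_ , ra) | inj₁ (refl , rb)  = subst₂ (λ s t → IsMinCut G s t A) (sym ra) (sym rb)
    (mincut-move-sink G mc Au λ A' A'v A'u →
      ℚ.≤-trans (ℚ.≤-reflexive capacity)
        (uv-cut-bound k (ends-incident {e = lookup T k} (ends-sym {e = lookup T k} ab))
                      (ends-sym {e = lookup T i} uv) A' A'v A'u))
    where
    Au : A u ≡ false
    Au with A u in Au≡true
    ... | false = refl
    ... | true  = ⊥-elim (case trans (sym Av) (proj₁ (proj₂ mc)) of λ ())
      where
      -- a reaches u, hence v, in T minus edge k; so v would lie on a's side
      Av : A v ≡ true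
      Av = Equivalence.from (side v) (subst (Conn _ a) (sym β-v)
             (reach-++ (subst (Conn _ a) β-u (Equivalence.to (side u) Au≡true))
                       (walk⇒conn-removeAt T k (uv-walk k≢i))))
  ... | inj₂ (_ , ra) | inj₂ (_ , rb) = subst₂ (λ s t → IsMinCut G s t A) (sym ra) (sym rb) mc

  contract-cuts : ∀ j → SideCut G T' (r ∘ β) j (src (lookup T' j)) (tgt (lookup T' j)) (lookup T' j)
                      × SideCut G T' (r ∘ β) j (tgt (lookup T' j)) (src (lookup T' j)) (lookup T' j)
  contract-cuts j rewrite lookup-origin j = from-src , from-tgt
    where
    k = origin j
    s = src (lookup T k)
    t = tgt (lookup T k)

    from-src : SideCut G T' (r ∘ β) j (r s) (r t) (lookup T k)
    from-src A side' with side ← side-pullback {a = s} j side'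
                     with mc , capacity ← proj₁ (cuts k) A side =
      cut-transfer k (origin-≢ j) (inj₁ (refl , refl)) side mc capacity , capacity

    from-tgt : SideCut G T' (r ∘ β) j (r t) (r s) (lookup T k)
    from-tgt A side' with side ← side-pullback {a = t} j side'
                     with mc , capacity ← proj₂ (cuts k) A side =
      cut-transfer k (origin-≢ j) (inj₂ (refl , refl)) side mc capacity , capacity

  contract-isGHTree : IsGHTree G (Z ─ ⁅ v ⁆) T' (r ∘ β)
  contract-isGHTree = contract-isTree tree , (λ y → rename-∈ tree (β∈Z y)) , fixed , contract-cuts
    where
    fixed : ∀ z → z ∈ Z ─ ⁅ v ⁆ → r (β z) ≡ z
    fixed z z∈ = trans (cong r (β-fixed z (proj₁ (∈-minus⁻ z∈)))) (rename-∉ tree z∈)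

-- Lemma 4.
lemma4 : ∀ {n : ℕ} (G : List (Edge n)) → (∀ e → e ∈ₗ G → 0ℚ ≤ℚ cap e) →
  (Z : Subset n) → 2 ≤ ∣ Z ∣ →
  (T : List (Edge n)) (β : Fin n → Fin n) →
  IsGHTree G Z T β → IsBagMinor G T β →
  (u v : Fin n) → v ∈ Z → (i : Fin (length T)) → EndsAre (lookup T i) u v →
  (∀ (j : Fin (length T)) → Incident (lookup T j) v → cap (lookup T j) ≤ℚ cap (lookup T i)) →
  IsGHTree G (Z ─ ⁅ v ⁆) (contract T i u v) (rename v u ∘ β) ×
  IsBagMinor G (contract T i u v) (rename v u ∘ β)
lemma4 G _ _ _ T _ gh bm u v _ i uv maximum =
  ContractGH.contract-isGHTree G gh u v i uv maximum , Contraction.contract-isBagMinor T i u v uv bm
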